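{- Let $\sigma,\pi\in G_{r,n}$ and $I\subseteq[n]$. Then $\sigma\in\mathcal{CL}(Z(I,\pi))$ if and only if $\mathrm{Des}(\sigma^{ -1}\pi)=I$.
   Context: Fix integers $r\ge1$, $n\ge1$, $[n]=\{1,\dots,n\}$. For a totally ordered set $Y$, $Y_{(r)}=\{0,\dots,r-1\}\times Y$ ordered lexicographically; write $x_k$ for $(k,x)$, $|x_k|=x$, $\epsilon(x_k)=k$; colors read mod $r$. $G_{r,n}$ is the group under composition of bijections $\pi$ of $[n]_{(r)}$ with $\pi(i_j)=k_l\Rightarrow\pi(i_{j+a})=k_{l+a}$ (mod $r$); one-line notation $\pi(1)\cdots\pi(n)$, $\pi(i)=\pi(i_0)$; product: if $\pi(i)=j_k$, $\sigma(j)=l_p$ then $(\sigma\pi)(i)=l_{k+p}$. $\mathrm{Des}(\pi)=\{i\in[n]:\pi(i)>\pi(i+1)\}$ in $[0,n]_{(r)}$ with $\pi(n+1)=0_1$. An $r$-colored poset is a set $P=\{0_1,\dots,0_{r-1}\}\cup Q$, $Q\subseteq[n]_{(r)}$ with distinct absolute values, with a partial order $\prec$ such that $0_1\prec\cdots\prec0_{r-1}$. $G^0_{r,n}$ is the set of shuffles of the one-line word of some $\pi\in G_{r,n}$ with $0_10_2\cdots0_{r-1}$. For $w\in G^0_{r,n}$ the $0$-letters split $w$ into $r$ (possibly empty) subwords numbered $0,\dots,r-1$ left to right; $\pi_i$ is subword $i$ with $i$ subtracted (mod $r$) from each color; $\mathcal{CL}(w)$ is the set of shuffles of $\pi_0,\dots,\pi_{r-1}$.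 For $P$ with one element of each absolute value $1,\dots,n$, $\mathcal{L}(P)$ is the set of $w\in G^0_{r,n}$ with letters the elements of $P$ such that $x\prec y$ implies $x$ left of $y$ in $w$, and $\mathcal{CL}(P)=\bigcup_{w\in\mathcal{L}(P)}\mathcal{CL}(w)$. The colored zig-zag poset $Z(I,\pi)$ is the $r$-colored poset on $\{\pi(1),\dots,\pi(n),0_1,\dots,0_{r-1}\}$ whose order is generated by $0_1\prec\cdots\prec0_{r-1}$ and, for each $i\in[n]$ (with $\pi(n+1)=0_1$), $\pi(i)\prec\pi(i+1)$ if $i\notin I$ and $\pi(i)\succ\pi(i+1)$ if $i\in I$. -}

module Defs where

open import Data.Nat using (ℕ; zero; suc; _+_; _∸_; _<_; _<?_; NonZero; _<ᵇ_; _≡ᵇ_; _%_)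
open import Data.Nat.DivMod using (_mod_)
open import Data.Fin using (Fin; toℕ; fromℕ<)
open import Data.Fin.Permutation using (Permutation′; _⟨$⟩ʳ_; _∘ₚ_; flip)
open import Data.Fin.Subset using (Subset; _∈_; _∉_; inside; outside)
open import Data.Bool using (Bool; true; false; _∨_; _∧_; if_then_else_)
open import Data.Vec using (tabulate)
open import Data.List using (List; []; _∷_; _++_; map; upTo)
import Data.List as L
open import Data.Maybe using (Maybe; just; nothing)
open import Data.Product using (_×_; _,_; Σ; ∃; ∃-syntax)
open import Relation.Nullary using (yes; no)
open import Relation.Binary.PropositionalEquality using (_≡_)
open import Relation.Binary.Construct.Closure.Transitive using (TransClosure)
open import Data.List.Relation.Ternary.Interleaving.Propositional using (Interleaving)
open import Data.List.Relation.Binary.Permutation.Propositional using (_↭_)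

-- Conventions.
--  * The absolute value x ∈ [n] = {1,…,n} is represented by v : Fin n
--    with x = toℕ v + 1.  The absolute value 0 (of the letters 0_k) is ℕ 0.
--  * Colours are elements of Fin r (r ≥ 1, NonZero); arithmetic mod r.
--  * The index i ∈ [n] (positions, descents, elements of I) is represented
--    by Fin n with i = toℕ + 1; a subset I ⊆ [n] is a Subset n.

module _ (r : ℕ) .{{_ : NonZero r}} where

  _+ᶜ_ : Fin r → Fin r → Fin r
  a +ᶜ b = (toℕ a + toℕ b) mod r

  -ᶜ_ : Fin r → Fin r
  -ᶜ a = (r ∸ toℕ a) mod r

  _-ᶜℕ_ : Fin r → ℕ → Fin r
  a -ᶜℕ k = (toℕ a + (r ∸ (k % r))) mod r

  one : Fin r
  one = 1 mod r

-- The coloured permutation group G_{r,n}.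
-- π(i) = (col i)-coloured copy of (perm i):  π(i) = (perm ⟨$⟩ʳ i)_{col i}.
-- Such a π determines the bijection of [n]_(r) by π(i_j) = (perm i)_{col i + j}.

record G (r n : ℕ) : Set where
  constructor mkG
  field
    perm : Permutation′ n
    col  : Fin n → Fin r
open G public

module _ {r n : ℕ} .{{_ : NonZero r}} where

  -- product: if π(i) = j_k and σ(j) = l_p then (σπ)(i) = l_{k+p}
  _·_ : G r n → G r n → G r n
  σ · π = mkG (perm π ∘ₚ perm σ)
              (λ i → _+ᶜ_ r (col π i) (col σ (perm π ⟨$⟩ʳ i)))

  -- inverse: if σ(m) = j_c then σ⁻¹(j) = m_{-c}
  _⁻¹ : G r n → G r n
  σ ⁻¹ = mkG (flip (perm σ)) (λ j → -ᶜ_ r (col σ (flip (perm σ) ⟨$⟩ʳ j)))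

data Letter (r n : ℕ) : Set where
  val : Fin r → Fin n → Letter r n     -- val k v  is  (toℕ v + 1)_k
  zer : ℕ → Letter r n

module _ {r n : ℕ} .{{_ : NonZero r}} where

  colourOf : Letter r n → Fin r
  colourOf (val k v) = k
  colourOf (zer k)   = k mod r

  absOf : Letter r n → ℕ
  absOf (val k v) = suc (toℕ v)
  absOf (zer k)   = 0

  _>ᵇ_ : Letter r n → Letter r n → Bool
  a >ᵇ b = (toℕ (colourOf b) <ᵇ toℕ (colourOf a))
         ∨ ((toℕ (colourOf a) ≡ᵇ toℕ (colourOf b)) ∧ (absOf b <ᵇ absOf a))

nextIdx : {n : ℕ} → Fin n → Maybe (Fin n)
nextIdx {n} i with suc (toℕ i) <? n
... | yes p = just (fromℕ< p)
... | no _  = nothing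

module _ {r n : ℕ} .{{_ : NonZero r}} where

  at : G r n → Fin n → Letter r n
  at π i = val (col π i) (perm π ⟨$⟩ʳ i)

  -- π(i+1), with the convention π(n+1) = 0_1
  atNext : G r n → Fin n → Letter r n
  atNext π i with nextIdx i
  ... | just j  = at π j
  ... | nothing = zer 1

  Des : G r n → Subset n
  Des π = tabulate (λ i → at π i >ᵇ atNext π i)

  oneLine : G r n → List (Letter r n)
  oneLine π = L.tabulate (at π)

zeros : (r n : ℕ) → List (Letter r n)
zeros r n = map (λ k → zer (suc k)) (upTo (r ∸ 1))

module _ {r n : ℕ} .{{_ : NonZero r}} where

  IsG0 : List (Letter r n) → Set
  IsG0 w = ∃[ π ] Interleaving (oneLine π) (zeros r n) w

  private
    consHead : Letter r n → List (List (Letter r n)) → List (List (Letter r n))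
    consHead x []       = (x ∷ []) ∷ []
    consHead x (s ∷ ss) = (x ∷ s) ∷ ss

  subwords : List (Letter r n) → List (List (Letter r n))
  subwords []            = [] ∷ []
  subwords (zer k ∷ w)   = [] ∷ subwords w
  subwords (val c v ∷ w) = consHead (val c v) (subwords w)

  shiftLetter : ℕ → Letter r n → Letter r n
  shiftLetter i (val c v) = val (_-ᶜℕ_ r c i) v
  shiftLetter i (zer k)   = zer k

  shiftFrom : ℕ → List (List (Letter r n)) → List (List (Letter r n))
  shiftFrom i []       = []
  shiftFrom i (s ∷ ss) = map (shiftLetter i) s ∷ shiftFrom (suc i) ss

  pis : List (Letter r n) → List (List (Letter r n))
  pis w = shiftFrom 0 (subwords w)

data ShuffleOf {A : Set} : List (List A) → List A → Set where
  none : ShuffleOf [] []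
  more : ∀ {x xs y z} → ShuffleOf xs y → Interleaving x y z → ShuffleOf (x ∷ xs) z

module _ {r n : ℕ} .{{_ : NonZero r}} where

  _∈CL_ : List (Letter r n) → List (Letter r n) → Set
  u ∈CL w = ShuffleOf (pis w) u

record ColPoset (r n : ℕ) : Set₁ where
  field
    elems : List (Letter r n)
    _≺_   : Letter r n → Letter r n → Set
open ColPoset public

LeftOf : {A : Set} → A → A → List A → Set
LeftOf x y w = ∃[ a ] ∃[ b ] ∃[ c ] (w ≡ a ++ (x ∷ b) ++ (y ∷ c))

module _ {r n : ℕ} .{{_ : NonZero r}} where

  InL : ColPoset r n → List (Letter r n) → Set
  InL P w = IsG0 w × (w ↭ elems P)
          × (∀ x y → _≺_ P x y → LeftOf x y w)

  InCLP : ColPoset r n → List (Letter r n) → Set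
  InCLP P u = ∃[ w ] (InL P w × u ∈CL w)

module _ {r n : ℕ} .{{_ : NonZero r}} where

  data ZGen (I : Subset n) (π : G r n) : Letter r n → Letter r n → Set where
    zchain : ∀ k → 1 Data.Nat.≤ k → suc k < r → ZGen I π (zer k) (zer (suc k))
    up     : ∀ i → i ∉ I → ZGen I π (at π i) (atNext π i)
    down   : ∀ i → i ∈ I → ZGen I π (atNext π i) (at π i)

  Z : Subset n → G r n → ColPoset r n
  Z I π = record
    { elems = oneLine π ++ zeros r n
    ; _≺_   = TransClosure (ZGen I π)
    }

{-# OPTIONS --safe #-}
module Submission where

-- Write τ = σ⁻¹π.  Give every letter x the key (colour, absolute value) of σ⁻¹(x), ordered
-- lexicographically, and give 0_k the key (k, 0).  Then π(i) and π(i+1) carry the keys of τ(i) and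
-- τ(i+1), so Des τ is the set of places where the key drops along π.
-- If w ∈ G⁰ and σ ∈ CL(w), the k-th subword of w recoloured by -k is a subword of the one-line word
-- of σ, so its letters have keys (k, p) with p increasing, and 0_{k+1} separates them from the next
-- subword: w is strictly increasing in the key.  For w ∈ L(Z(I, π)) every generating relation of
-- Z(I, π) therefore increases the key, which says exactly that Des τ = I.  Conversely, if Des τ = I,
-- the letters of π sorted by key, with 0_1, …, 0_{r-1} inserted between the levels, form such a w.

open import Defs
open import Data.Nat using (ℕ; _≤_; NonZero)
open import Data.Fin.Subset using (Subset)
open import Relation.Binary.PropositionalEquality using (_≡_)
open import Function.Bundles using (_⇔_)

open import Data.Bool using (T)
open import Data.Bool.Properties using (T-∨; T-∧; T-≡)
open import Data.Empty using (⊥; ⊥-elim)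
open import Data.Fin using (Fin; toℕ; cast)
import Data.Fin as Fin
open import Data.Fin.Properties using (toℕ-fromℕ<; toℕ<n; toℕ-injective)
open import Data.Fin.Permutation
  using (Permutation; Permutation′; _⟨$⟩ʳ_; _⟨$⟩ˡ_; _∘ₚ_; flip; inverseˡ; inverseʳ; cast-id; ↔⇒≡)
open import Data.Fin.Subset using () renaming (_∈_ to _∈ₛ_; _∉_ to _∉ₛ_; _⊆_ to _⊆ₛ_)
import Data.Fin.Subset.Properties as Subset
open import Data.List
  using (List; []; _∷_; _++_; map; concat; filter; tabulate; lookup; length; allFin; applyUpTo)
open import Data.List.Properties
  using (map-∘; map-cong-local; map-tabulate; concat-map; length-map; map-applyUpTo; ++-identityʳ; ++-assoc;
         filter-accept; filter-reject; tabulate-cong; tabulate-lookup; length-tabulate)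
open import Data.List.Membership.Propositional using (_∈_)
open import Data.List.Membership.Propositional.Properties
  using (∈-++⁺ˡ; ∈-++⁺ʳ; ∈-tabulate⁺; ∈-upTo⁺; ∈-∃++; ∈-++⁻; ∈-map⁺; ∈-allFin)
open import Data.List.Membership.Propositional.Properties.WithK using (unique∧set⇒bag)
open import Data.List.Relation.Binary.BagAndSetEquality using (∼bag⇒↭)
open import Data.List.Relation.Binary.Equality.Propositional using (≋-refl)
open import Data.List.Relation.Binary.Permutation.Propositional
  using (_↭_; ↭-refl; ↭-sym; ↭-trans; ↭⇒↭ₛ; module PermutationReasoning)
import Data.List.Relation.Binary.Permutation.Propositional.Properties as ↭
import Data.List.Relation.Binary.Permutation.Setoid as ↭ₛ
import Data.List.Relation.Binary.Permutation.Setoid.Properties as ↭ₛ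
open import Data.List.Relation.Binary.Sublist.Propositional using (_⊆_; _⊇_; []; _∷_; _∷ʳ_; ⊆-trans)
open import Data.List.Relation.Binary.Sublist.Propositional.Properties using (All-resp-⊆)
open import Data.List.Relation.Ternary.Interleaving.Propositional
  using (Interleaving; consˡ; consʳ; swap; toPermutation)
import Data.List.Relation.Ternary.Interleaving as Interleaving
import Data.List.Relation.Ternary.Interleaving.Properties as Interleaving
open import Data.List.Relation.Unary.All using (All; []; _∷_)
import Data.List.Relation.Unary.All as All
import Data.List.Relation.Unary.All.Properties as All
open import Data.List.Relation.Unary.AllPairs using (AllPairs; []; _∷_)
import Data.List.Relation.Unary.AllPairs as AllPairs
import Data.List.Relation.Unary.AllPairs.Properties as AllPairs
open import Data.List.Relation.Unary.Any using (here; there)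
import Data.List.Relation.Unary.Unique.Propositional.Properties as Unique
open import Data.Maybe using (just; nothing)
open import Data.Nat using (zero; suc; _+_; _∸_; _<_; _%_; _≟_; _<?_; z≤n; s≤s)
open import Data.Nat.DivMod using (_mod_; %-distribˡ-+; m%n%n≡m%n; [m+n]%n≡m%n; m%n≤n; m%n<n; m<n⇒m%n≡m)
open import Data.Nat.Properties
  using (<-strictTotalOrder; <-trans; <⇒≤; <⇒≢; ≤⇒≯; ≤∧≢⇒<; ≤-reflexive; n<1+n; m<n⇒m<1+n; m+n≤o⇒m≤o;
         suc[m]≤n⇒m≤pred[n]; suc-pred; suc-injective; 1+n≢n; +-comm; +-assoc; +-suc; +-identityʳ; m∸n+n≡m;
         <ᵇ⇒<; <⇒<ᵇ; ≡ᵇ⇒≡; ≡⇒≡ᵇ)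
open import Data.Product using (_×_; _,_; ∃; ∃-syntax; proj₁; proj₂)
open import Data.Product.Relation.Binary.Lex.Strict using (×-Lex; ×-strictTotalOrder)
open import Data.Sum using (inj₁; inj₂)
open import Data.Unit using (⊤; tt)
open import Data.Vec.Properties using (lookup∘tabulate; []=⇒lookup; lookup⇒[]=)
open import Function using (id; _∘_; _on_)
open import Function.Bundles using (Equivalence; Injection; mk⇔)
open import Function.Properties.Inverse using (↔⇒↣)
open import Level using (Level; 0ℓ)
open import Relation.Binary using (Rel; Asymmetric; _Respects_; StrictTotalOrder; tri<; tri≈; tri>)
open import Relation.Binary.Construct.Closure.Transitive using (TransClosure; [_]; _∷_)
open import Relation.Binary.PropositionalEquality
  using (_≢_; refl; sym; trans; cong; cong₂; subst; subst₂; setoid; module ≡-Reasoning)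
open import Relation.Nullary using (yes; no)

private
  variable
    ℓ : Level
    B : Set

-- Sublists, shuffles and sorted lists

module _ {A : Set} where

  Interleaving⇒⊆ : ∀ {l r u : List A} → Interleaving l r u → l ⊆ u
  Interleaving⇒⊆ Interleaving.[] = []
  Interleaving⇒⊆ (consˡ i)       = refl ∷ Interleaving⇒⊆ i
  Interleaving⇒⊆ (consʳ i)       = _ ∷ʳ Interleaving⇒⊆ i

  ShuffleOf⇒⊆ : ∀ {ls} {u : List A} → ShuffleOf ls u → All (_⊆ u) ls
  ShuffleOf⇒⊆ none       = []
  ShuffleOf⇒⊆ (more s i) =
    Interleaving⇒⊆ i ∷ All.map (λ p → ⊆-trans p (Interleaving⇒⊆ (swap i))) (ShuffleOf⇒⊆ s)

  ShuffleOf⇒↭concat : ∀ {ls} {u : List A} → ShuffleOf ls u → u ↭ concat ls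
  ShuffleOf⇒↭concat none       = ↭-refl
  ShuffleOf⇒↭concat (more {x} s i) = ↭-trans (toPermutation i) (↭.++⁺ˡ x (ShuffleOf⇒↭concat s))

  ShuffleOf-map : (f : A → B) → ∀ {ls} {u : List A} → ShuffleOf ls u → ShuffleOf (map (map f) ls) (map f u)
  ShuffleOf-map f none       = none
  ShuffleOf-map f (more s i) =
    more (ShuffleOf-map f s) (Interleaving.map⁺ f f f (Interleaving.map (cong f) (cong f) i))

  AllPairs-resp-⊆ : {R : Rel A ℓ} → (AllPairs R) Respects _⊇_
  AllPairs-resp-⊆ []          []       = []
  AllPairs-resp-⊆ (_ ∷ʳ p)    (_ ∷ rs) = AllPairs-resp-⊆ p rs
  AllPairs-resp-⊆ (refl ∷ p)  (r ∷ rs) = All-resp-⊆ p r ∷ AllPairs-resp-⊆ p rs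

  AllPairs-combine : {P : A → Set} {R S : Rel A ℓ} → (∀ {x y} → P x → P y → R x y → S x y) →
                     ∀ {xs} → All P xs → AllPairs R xs → AllPairs S xs
  AllPairs-combine f []         []         = []
  AllPairs-combine f (px ∷ pxs) (rx ∷ rxs) =
    All.zipWith (λ py∧rxy → f px (proj₁ py∧rxy) (proj₂ py∧rxy)) (pxs , rx) ∷ AllPairs-combine f pxs rxs

  module _ {R : Rel A ℓ} where

    LeftOf⇒related : ∀ {x y w} → AllPairs R w → LeftOf x y w → R x y
    LeftOf⇒related (r ∷ _)  ([]    , b , c , refl) = All.head (All.++⁻ʳ b r)
    LeftOf⇒related (_ ∷ rs) (_ ∷ a , b , c , refl) = LeftOf⇒related rs (a , b , c , refl)

    related⇒LeftOf : Asymmetric R → ∀ {x y w} → AllPairs R w → x ∈ w → y ∈ w → R x y → LeftOf x y w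
    related⇒LeftOf asym {x} {y} rs x∈w y∈w xRy with ∈-∃++ x∈w
    ... | a , b , refl with ∈-++⁻ a y∈w
    ...   | inj₂ (here refl) = ⊥-elim (asym xRy xRy)
    ...   | inj₂ (there y∈b) = let c , d , b≡ = ∈-∃++ y∈b in a , c , d , cong (λ t → a ++ x ∷ t) b≡
    ...   | inj₁ y∈a with ∈-∃++ y∈a
    ...     | c , d , refl = ⊥-elim (asym xRy (LeftOf⇒related rs (c , d , b , ++-assoc c (y ∷ d) (x ∷ b))))

  module _ (cls : A → ℕ) where

    fibre : ℕ → List A → List A
    fibre j = filter (λ x → cls x ≟ j)

    fibresFrom : ℕ → ℕ → List A → List (List A)
    fibresFrom j zero    u = []
    fibresFrom j (suc c) u = fibre j u ∷ fibresFrom (suc j) c u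

    length-fibresFrom : ∀ j c u → length (fibresFrom j c u) ≡ c
    length-fibresFrom j zero    u = refl
    length-fibresFrom j (suc c) u = cong suc (length-fibresFrom (suc j) c u)

    fibresFrom-skip : ∀ {x} j c u → cls x < j → fibresFrom j c (x ∷ u) ≡ fibresFrom j c u
    fibresFrom-skip j zero    u x<j = refl
    fibresFrom-skip j (suc c) u x<j =
      cong₂ _∷_ (filter-reject (λ y → cls y ≟ j) (<⇒≢ x<j)) (fibresFrom-skip (suc j) c u (m<n⇒m<1+n x<j))

    ShuffleOf-fibresFrom-∷ : ∀ {x v} j c u → j ≤ cls x → cls x < j + c →
                             ShuffleOf (fibresFrom j c u) v → ShuffleOf (fibresFrom j c (x ∷ u)) (x ∷ v)
    ShuffleOf-fibresFrom-∷ j zero u j≤x x<j+0 _ = ⊥-elim (≤⇒≯ j≤x (subst (_ <_) (+-identityʳ j) x<j+0))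
    ShuffleOf-fibresFrom-∷ {x} j (suc c) u j≤x x<j+c (more s i) with cls x ≟ j
    ... | yes x≡j rewrite filter-accept (λ y → cls y ≟ j) {x} {u} x≡j
                        | fibresFrom-skip (suc j) c u (subst (_< suc j) (sym x≡j) (n<1+n j)) =
      more s (consˡ i)
    ... | no x≢j rewrite filter-reject (λ y → cls y ≟ j) {x} {u} x≢j =
      more (ShuffleOf-fibresFrom-∷ (suc j) c u (≤∧≢⇒< j≤x (λ j≡x → x≢j (sym j≡x)))
                                   (subst (cls x <_) (+-suc j c) x<j+c) s)
           (consʳ i)

    ShuffleOf-fibresFrom : ∀ j c u → All (λ x → j ≤ cls x × cls x < j + c) u → ShuffleOf (fibresFrom j c u) u
    ShuffleOf-fibresFrom j zero    []      []                 = none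
    ShuffleOf-fibresFrom j (suc c) []      []                 =
      more (ShuffleOf-fibresFrom (suc j) c [] []) Interleaving.[]
    ShuffleOf-fibresFrom j c       (x ∷ u) ((lo , hi) ∷ bnds) =
      ShuffleOf-fibresFrom-∷ j c u lo hi (ShuffleOf-fibresFrom j c u bnds)

  lookup-tabulate-cast : ∀ {k} (f : Fin k → A) i → lookup (tabulate f) i ≡ f (cast (length-tabulate f) i)
  lookup-tabulate-cast {suc k} f Fin.zero    = refl
  lookup-tabulate-cast {suc k} f (Fin.suc i) = lookup-tabulate-cast (f ∘ Fin.suc) i

  tabulate-reindex : ∀ {k} {L : List A} (f : Fin k → A) (ρ : Permutation (length L) k) →
                     (∀ i → lookup L i ≡ f (ρ ⟨$⟩ʳ i)) →
                     ∃ λ (ρ′ : Permutation′ k) → tabulate (f ∘ (ρ′ ⟨$⟩ʳ_)) ≡ L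
  tabulate-reindex {L = L} f ρ L≗fρ with ↔⇒≡ ρ
  ... | refl = ρ , trans (tabulate-cong (λ i → sym (L≗fρ i))) (tabulate-lookup L)

  ↭-tabulate : ∀ {k} {L : List A} (f : Fin k → A) → L ↭ tabulate f →
               ∃ λ (ρ : Permutation′ k) → tabulate (f ∘ (ρ ⟨$⟩ʳ_)) ≡ L
  ↭-tabulate f L↭ = tabulate-reindex f (↭ₛ.onIndices (↭⇒↭ₛ L↭) ∘ₚ cast-id (length-tabulate f))
    (λ i → trans (↭ₛ.onIndices-lookup (setoid A) (↭⇒↭ₛ L↭) i) (lookup-tabulate-cast f _))

map-allFin-↭ : ∀ {n} (ρ : Permutation′ n) → map (ρ ⟨$⟩ʳ_) (allFin n) ↭ allFin n
map-allFin-↭ {n} ρ = ∼bag⇒↭ (unique∧set⇒bag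
  (Unique.map⁺ (Injection.injective (↔⇒↣ ρ)) (Unique.allFin⁺ n)) (Unique.allFin⁺ n)
  (mk⇔ (λ _ → ∈-allFin _)
       (λ _ → subst (_∈ map (ρ ⟨$⟩ʳ_) (allFin n)) (inverseʳ ρ) (∈-map⁺ (ρ ⟨$⟩ʳ_) (∈-allFin (ρ ⟨$⟩ˡ _))))))

-- Colours modulo r

module ColourArithmetic (r : ℕ) .{{_ : NonZero r}} where

  infixl 6 _⊕_ _⊖_
  infix  8 ⊝_

  _⊕_ : Fin r → Fin r → Fin r
  _⊕_ = _+ᶜ_ r

  ⊝_ : Fin r → Fin r
  ⊝_ = -ᶜ_ r

  _⊖_ : Fin r → ℕ → Fin r
  _⊖_ = _-ᶜℕ_ r

  infix 4 _≡ₘ_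
  _≡ₘ_ : ℕ → ℕ → Set
  a ≡ₘ b = a % r ≡ b % r

  toℕ-mod : ∀ m → toℕ (m mod r) ≡ m % r
  toℕ-mod m = toℕ-fromℕ< (m%n<n m r)

  toℕ-mod-< : ∀ {m} → m < r → toℕ (m mod r) ≡ m
  toℕ-mod-< m<r = trans (toℕ-mod _) (m<n⇒m%n≡m m<r)

  mod-≡ₘ : ∀ m → toℕ (m mod r) ≡ₘ m
  mod-≡ₘ m = trans (cong (_% r) (toℕ-mod m)) (m%n%n≡m%n m r)

  +-congˡₘ : ∀ a {b c} → b ≡ₘ c → a + b ≡ₘ a + c
  +-congˡₘ a {b} {c} b≡c = begin
    (a + b) % r         ≡⟨ %-distribˡ-+ a b r ⟩
    (a % r + b % r) % r ≡⟨ cong (λ x → (a % r + x) % r) b≡c ⟩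
    (a % r + c % r) % r ≡⟨ %-distribˡ-+ a c r ⟨
    (a + c) % r         ∎
    where open ≡-Reasoning

  +-congʳₘ : ∀ {a b} c → a ≡ₘ b → a + c ≡ₘ b + c
  +-congʳₘ {a} {b} c a≡b = subst₂ _≡ₘ_ (+-comm c a) (+-comm c b) (+-congˡₘ c a≡b)

  +-inverseₘ : ∀ a {b} → b ≤ r → a + (r ∸ b) + b ≡ₘ a
  +-inverseₘ a {b} b≤r = begin
    (a + (r ∸ b) + b) % r   ≡⟨ cong (_% r) (+-assoc a (r ∸ b) b) ⟩
    (a + ((r ∸ b) + b)) % r ≡⟨ cong (λ x → (a + x) % r) (m∸n+n≡m b≤r) ⟩
    (a + r) % r             ≡⟨ [m+n]%n≡m%n a r ⟩
    a % r                   ∎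
    where open ≡-Reasoning

  +-cancelʳₘ : ∀ {a b} c → a + c ≡ₘ b + c → a ≡ₘ b
  +-cancelʳₘ {a} {b} c a+c≡b+c = begin
    a % r                         ≡⟨ +-inverseₘ a (m%n≤n c r) ⟨
    (a + (r ∸ c % r) + c % r) % r ≡⟨ +-congˡₘ (a + (r ∸ c % r)) (m%n%n≡m%n c r) ⟩
    (a + (r ∸ c % r) + c) % r     ≡⟨ cong (_% r) (+-shuffle a (r ∸ c % r) c) ⟩
    (a + c + (r ∸ c % r)) % r     ≡⟨ +-congʳₘ (r ∸ c % r) a+c≡b+c ⟩
    (b + c + (r ∸ c % r)) % r     ≡⟨ cong (_% r) (+-shuffle b (r ∸ c % r) c) ⟨
    (b + (r ∸ c % r) + c) % r     ≡⟨ +-congˡₘ (b + (r ∸ c % r)) (m%n%n≡m%n c r) ⟨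
    (b + (r ∸ c % r) + c % r) % r ≡⟨ +-inverseₘ b (m%n≤n c r) ⟩
    b % r                         ∎
    where
    open ≡-Reasoning
    +-shuffle : ∀ x y z → x + y + z ≡ x + z + y
    +-shuffle x y z = trans (+-assoc x y z) (trans (cong (x +_) (+-comm y z)) (sym (+-assoc x z y)))

  ≡ₘ⇒≡ : ∀ {a b} → a < r → b < r → a ≡ₘ b → a ≡ b
  ≡ₘ⇒≡ a<r b<r a≡b = trans (sym (m<n⇒m%n≡m a<r)) (trans a≡b (m<n⇒m%n≡m b<r))

  toℕ-⊕ : ∀ a b → toℕ (a ⊕ b) ≡ₘ toℕ a + toℕ b
  toℕ-⊕ a b = mod-≡ₘ (toℕ a + toℕ b)

  ⊝-inverseˡ : ∀ c a → c + toℕ (⊝ a) + toℕ a ≡ₘ c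
  ⊝-inverseˡ c a = begin
    (c + toℕ (⊝ a) + toℕ a) % r  ≡⟨ +-congʳₘ (toℕ a) (+-congˡₘ c (mod-≡ₘ (r ∸ toℕ a))) ⟩
    (c + (r ∸ toℕ a) + toℕ a) % r ≡⟨ +-inverseₘ c (<⇒≤ (toℕ<n a)) ⟩
    c % r                         ∎
    where open ≡-Reasoning

  ⊖-inverseʳ : ∀ a k → toℕ (a ⊖ k) + k ≡ₘ toℕ a
  ⊖-inverseʳ a k = begin
    (toℕ (a ⊖ k) + k) % r               ≡⟨ +-congʳₘ k (mod-≡ₘ (toℕ a + (r ∸ k % r))) ⟩
    (toℕ a + (r ∸ k % r) + k) % r       ≡⟨ +-congˡₘ (toℕ a + (r ∸ k % r)) (m%n%n≡m%n k r) ⟨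
    (toℕ a + (r ∸ k % r) + k % r) % r   ≡⟨ +-inverseₘ (toℕ a) (m%n≤n k r) ⟩
    toℕ a % r                           ∎
    where open ≡-Reasoning

  c⊕⊝[c⊖j]≡j : ∀ c {j} → j < r → toℕ (c ⊕ ⊝ (c ⊖ j)) ≡ j
  c⊕⊝[c⊖j]≡j c {j} j<r = ≡ₘ⇒≡ (toℕ<n (c ⊕ ⊝ e)) j<r (+-cancelʳₘ (toℕ e) (begin
    (toℕ (c ⊕ ⊝ e) + toℕ e) % r     ≡⟨ +-congʳₘ (toℕ e) (toℕ-⊕ c (⊝ e)) ⟩
    (toℕ c + toℕ (⊝ e) + toℕ e) % r ≡⟨ ⊝-inverseˡ (toℕ c) e ⟩
    toℕ c % r                       ≡⟨ ⊖-inverseʳ c j ⟨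
    (toℕ e + j) % r                 ≡⟨ cong (_% r) (+-comm (toℕ e) j) ⟩
    (j + toℕ e) % r                 ∎))
    where
    open ≡-Reasoning
    e : Fin r
    e = c ⊖ j

  c⊖[c⊕⊝d]≡d : ∀ c d → c ⊖ toℕ (c ⊕ ⊝ d) ≡ d
  c⊖[c⊕⊝d]≡d c d = toℕ-injective (≡ₘ⇒≡ (toℕ<n (c ⊖ k)) (toℕ<n d) (+-cancelʳₘ k (begin
    (toℕ (c ⊖ k) + k) % r           ≡⟨ ⊖-inverseʳ c k ⟩
    toℕ c % r                       ≡⟨ ⊝-inverseˡ (toℕ c) d ⟨
    (toℕ c + toℕ (⊝ d) + toℕ d) % r ≡⟨ +-congʳₘ (toℕ d) (toℕ-⊕ c (⊝ d)) ⟨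
    (k + toℕ d) % r                 ≡⟨ cong (_% r) (+-comm k (toℕ d)) ⟩
    (toℕ d + k) % r                 ∎)))
    where
    open ≡-Reasoning
    k : ℕ
    k = toℕ (c ⊕ ⊝ d)

-- Letters, descents and the words of G⁰

infix 4 _<ₗₑₓ_
_<ₗₑₓ_ : Rel (ℕ × ℕ) 0ℓ
_<ₗₑₓ_ = ×-Lex _≡_ _<_ _<_

module <ₗₑₓ = StrictTotalOrder (×-strictTotalOrder <-strictTotalOrder <-strictTotalOrder)

val-injective : ∀ {r n} {a b : Fin r} {v w : Fin n} → val a v ≡ val b w → a ≡ b × v ≡ w
val-injective refl = refl , refl

nextIdx-suc : ∀ {n} (i j : Fin n) → nextIdx i ≡ just j → toℕ j ≡ suc (toℕ i)
nextIdx-suc {n} i j eq with suc (toℕ i) <? n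
nextIdx-suc i j refl | yes i+1<n = toℕ-fromℕ< i+1<n

module _ {r n : ℕ} .{{_ : NonZero r}} where

  coords : Letter r n → ℕ × ℕ
  coords x = toℕ (colourOf x) , absOf x

  >ᵇ⇔<ₗₑₓ : ∀ x y → T (x >ᵇ y) ⇔ coords y <ₗₑₓ coords x
  >ᵇ⇔<ₗₑₓ x y = mk⇔ to from
    where
    to : T (x >ᵇ y) → coords y <ₗₑₓ coords x
    to x>y with Equivalence.to T-∨ x>y
    ... | inj₁ cy<cx = inj₁ (<ᵇ⇒< _ _ cy<cx)
    ... | inj₂ cx≡cy∧ay<ax with Equivalence.to T-∧ cx≡cy∧ay<ax
    ...   | cx≡cy , ay<ax = inj₂ (sym (≡ᵇ⇒≡ _ _ cx≡cy) , <ᵇ⇒< _ _ ay<ax)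
    from : coords y <ₗₑₓ coords x → T (x >ᵇ y)
    from (inj₁ cy<cx) = Equivalence.from T-∨ (inj₁ (<⇒<ᵇ cy<cx))
    from (inj₂ (cy≡cx , ay<ax)) =
      Equivalence.from T-∨ (inj₂ (Equivalence.from T-∧ (≡⇒≡ᵇ _ _ (sym cy≡cx) , <⇒<ᵇ ay<ax)))

  ∈-Des⇔ : ∀ (ρ : G r n) i → i ∈ₛ Des ρ ⇔ coords (atNext ρ i) <ₗₑₓ coords (at ρ i)
  ∈-Des⇔ ρ i = mk⇔
    (λ i∈Des → Equivalence.to (>ᵇ⇔<ₗₑₓ _ _)
      (Equivalence.from T-≡ (trans (sym (lookup∘tabulate _ i)) ([]=⇒lookup i∈Des))))
    (λ next<at → lookup⇒[]= i (Des ρ)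
      (trans (lookup∘tabulate _ i) (Equivalence.to T-≡ (Equivalence.from (>ᵇ⇔<ₗₑₓ _ _) next<at))))

  absOf-at-injective : ∀ (ρ : G r n) {i j} → absOf (at ρ i) ≡ absOf (at ρ j) → i ≡ j
  absOf-at-injective ρ = Injection.injective (↔⇒↣ (perm ρ)) ∘ toℕ-injective ∘ suc-injective

  absOf-at≢absOf-atNext : ∀ (ρ : G r n) i → absOf (at ρ i) ≢ absOf (atNext ρ i)
  absOf-at≢absOf-atNext ρ i with nextIdx i in eq
  ... | just j  = λ same-abs →
    1+n≢n (trans (sym (nextIdx-suc i j eq)) (cong toℕ (sym (absOf-at-injective ρ same-abs))))
  ... | nothing = λ ()

  ↭-oneLine : ∀ (π : G r n) {L} → L ↭ oneLine π → ∃[ π′ ] oneLine π′ ≡ L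
  ↭-oneLine π L↭ = let ρ , oneLine≡ = ↭-tabulate (at π) L↭ in mkG (ρ ∘ₚ perm π) (col π ∘ (ρ ⟨$⟩ʳ_)) , oneLine≡

  IsVal : Letter r n → Set
  IsVal (val _ _) = ⊤
  IsVal (zer _)   = ⊥

  zerosFrom : ℕ → ℕ → List (Letter r n)
  zerosFrom j zero    = []
  zerosFrom j (suc c) = zer (suc j) ∷ zerosFrom (suc j) c

  applyUpTo-zerosFrom : ∀ j c (f : ℕ → Letter r n) → (∀ k → f k ≡ zer (suc (j + k))) →
                        applyUpTo f c ≡ zerosFrom j c
  applyUpTo-zerosFrom j zero    f f≗ = refl
  applyUpTo-zerosFrom j (suc c) f f≗ =
    cong₂ _∷_ (trans (f≗ 0) (cong (zer ∘ suc) (+-identityʳ j)))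
              (applyUpTo-zerosFrom (suc j) c (f ∘ suc)
                 (λ k → trans (f≗ (suc k)) (cong (zer ∘ suc) (+-suc j k))))

  zeros≡zerosFrom : zeros r n ≡ zerosFrom 0 (r ∸ 1)
  zeros≡zerosFrom = trans (map-applyUpTo id (zer ∘ suc) (r ∸ 1))
                          (applyUpTo-zerosFrom 0 (r ∸ 1) (zer ∘ suc) (λ _ → refl))

  joinFrom : ℕ → List (List (Letter r n)) → List (Letter r n)
  joinFrom j []            = []
  joinFrom j (b ∷ [])      = b
  joinFrom j (b ∷ b′ ∷ bs) = b ++ zer (suc j) ∷ joinFrom (suc j) (b′ ∷ bs)

  joinFrom-∷ : ∀ j x b bs → x ∷ joinFrom j (b ∷ bs) ≡ joinFrom j ((x ∷ b) ∷ bs)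
  joinFrom-∷ j x b []       = refl
  joinFrom-∷ j x b (_ ∷ _) = refl

  Interleaving⇒joinFrom : ∀ {l w} j c → All IsVal l → Interleaving l (zerosFrom j c) w →
    ∃[ b ] ∃[ bs ] length bs ≡ c × All (All IsVal) (b ∷ bs) × w ≡ joinFrom j (b ∷ bs)
  Interleaving⇒joinFrom j zero [] Interleaving.[] = [] , [] , refl , [] ∷ [] , refl
  Interleaving⇒joinFrom {x ∷ _} j c (x-val ∷ vals) (consˡ i) with Interleaving⇒joinFrom j c vals i
  ... | b , bs , len , (b-vals ∷ bs-vals) , refl =
    x ∷ b , bs , len , (x-val ∷ b-vals) ∷ bs-vals , joinFrom-∷ j x b bs
  Interleaving⇒joinFrom j (suc c) vals (consʳ i) with Interleaving⇒joinFrom (suc j) c vals i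
  ... | b , bs , refl , bs-vals , refl = [] , b ∷ bs , refl , [] ∷ bs-vals , refl

  joinFrom-interleaving : ∀ j b bs →
                          Interleaving (concat (b ∷ bs)) (zerosFrom j (length bs)) (joinFrom j (b ∷ bs))
  joinFrom-interleaving j b []        =
    subst (λ l → Interleaving l [] b) (sym (++-identityʳ b)) (Interleaving.left ≋-refl)
  joinFrom-interleaving j b (b′ ∷ bs) =
    Interleaving.++⁺ (Interleaving.left ≋-refl) (consʳ (joinFrom-interleaving (suc j) b′ bs))

  subwords-val : ∀ {b} → All IsVal b → subwords b ≡ b ∷ []
  subwords-val []                            = refl
  subwords-val {val _ _ ∷ _} (_ ∷ vals) rewrite subwords-val vals = refl

  subwords-++ : ∀ {b} k w → All IsVal b → subwords (b ++ zer k ∷ w) ≡ b ∷ subwords w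
  subwords-++ k w []                                 = refl
  subwords-++ {val _ _ ∷ _} k w (_ ∷ vals) rewrite subwords-++ k w vals = refl

  subwords-joinFrom : ∀ j b bs → All (All IsVal) (b ∷ bs) → subwords (joinFrom j (b ∷ bs)) ≡ b ∷ bs
  subwords-joinFrom j b []        (vals ∷ [])    = subwords-val vals
  subwords-joinFrom j b (b′ ∷ bs) (vals ∷ valss) =
    trans (subwords-++ (suc j) _ vals) (cong (b ∷_) (subwords-joinFrom (suc j) b′ bs valss))

-- key x = coords of σ⁻¹(x), so that key (at π i) is coords (at ((σ ⁻¹) · π) i) by definition.

module Key {r n : ℕ} .{{_ : NonZero r}} (σ : G r n) where

  open ColourArithmetic r

  level : Letter r n → ℕ
  level (val c v) = toℕ (c ⊕ col (σ ⁻¹) v)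
  level (zer k)   = k

  position : Letter r n → ℕ
  position (val c v) = suc (toℕ (perm (σ ⁻¹) ⟨$⟩ʳ v))
  position (zer k)   = 0

  key : Letter r n → ℕ × ℕ
  key x = level x , position x

  infix 4 _<ₖ_
  _<ₖ_ : Rel (Letter r n) 0ℓ
  _<ₖ_ = _<ₗₑₓ_ on key

  level-shift : ∀ {j x m} → j < r → shiftLetter j x ≡ at σ m → level x ≡ j
  level-shift {j} {val c v} {m} j<r eq with val-injective eq
  ... | c⊖j≡σm , refl = begin
    toℕ (c ⊕ ⊝ col σ (perm σ ⟨$⟩ˡ (perm σ ⟨$⟩ʳ m))) ≡⟨ cong (λ i → toℕ (c ⊕ ⊝ col σ i)) (inverseˡ (perm σ)) ⟩
    toℕ (c ⊕ ⊝ col σ m)                              ≡⟨ cong (λ d → toℕ (c ⊕ ⊝ d)) c⊖j≡σm ⟨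
    toℕ (c ⊕ ⊝ (c ⊖ j))                              ≡⟨ c⊕⊝[c⊖j]≡j c j<r ⟩
    j                                                ∎
    where open ≡-Reasoning

  shift-by-level : ∀ c v → shiftLetter (level (val c v)) (val c v) ≡ at σ (perm (σ ⁻¹) ⟨$⟩ʳ v)
  shift-by-level c v = cong₂ val (c⊖[c⊕⊝d]≡d c _) (sym (inverseʳ (perm σ)))

  position-shift : ∀ j x → position (shiftLetter j x) ≡ position x
  position-shift j (val _ _) = refl
  position-shift j (zer _)   = refl

  IsVal⇒0<position : ∀ {x} → IsVal x → 0 < position x
  IsVal⇒0<position {val _ _} _ = s≤s z≤n

  position-at : ∀ m → position (at σ m) ≡ suc (toℕ m)
  position-at m = cong (suc ∘ toℕ) (inverseˡ (perm σ))

  oneLine-positions : AllPairs (_<_ on position) (oneLine σ)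
  oneLine-positions = AllPairs.tabulate⁺-< (λ {i} {j} i<j →
    subst₂ _<_ (sym (position-at i)) (sym (position-at j)) (s≤s i<j))

  oneLine-letters : All (λ y → ∃[ m ] y ≡ at σ m) (oneLine σ)
  oneLine-letters = All.tabulate⁺ (λ m → m , refl)

  block-levels : ∀ {j b} → j < r → map (shiftLetter j) b ⊆ oneLine σ → All (λ x → level x ≡ j) b
  block-levels j<r b⊆σ = All.map (λ σ-letter → level-shift j<r (proj₂ σ-letter))
    (All.map⁻ (All-resp-⊆ b⊆σ oneLine-letters))

  block-positions : ∀ {j b} → map (shiftLetter j) b ⊆ oneLine σ → AllPairs (_<_ on position) b
  block-positions {j} b⊆σ = AllPairs.map (λ {x} {y} → subst₂ _<_ (position-shift j x) (position-shift j y))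
    (AllPairs.map⁻ (AllPairs-resp-⊆ b⊆σ oneLine-positions))

  block-sorted : ∀ {j b} → All (λ x → level x ≡ j) b → AllPairs (_<_ on position) b → AllPairs _<ₖ_ b
  block-sorted = AllPairs-combine (λ x≡j y≡j px<py → inj₂ (trans x≡j (sym y≡j) , px<py))

  block-above : ∀ {j b} → All (λ x → level x ≡ j) b → All IsVal b → All (λ y → (j , 0) <ₗₑₓ key y) b
  block-above levels vals =
    All.zipWith (λ x≡j∧val → inj₂ (sym (proj₁ x≡j∧val) , IsVal⇒0<position (proj₂ x≡j∧val))) (levels , vals)

  joinFrom-sorted : ∀ j bs → j + length bs ≤ r → All (All IsVal) bs → All (_⊆ oneLine σ) (shiftFrom j bs) →
                    AllPairs _<ₖ_ (joinFrom j bs) × All (λ y → (j , 0) <ₗₑₓ key y) (joinFrom j bs)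
  joinFrom-sorted j []            _     _              _             = [] , []
  joinFrom-sorted j (b ∷ [])      j+1≤r (vals ∷ [])    (b⊆σ ∷ [])    =
    block-sorted levels (block-positions b⊆σ) , block-above levels vals
    where
    levels : All (λ x → level x ≡ j) b
    levels = block-levels (subst (_≤ r) (+-comm j 1) j+1≤r) b⊆σ
  joinFrom-sorted j (b ∷ b′ ∷ bs) bound (vals ∷ valss) (b⊆σ ∷ bs⊆σ)
    with joinFrom-sorted (suc j) (b′ ∷ bs) (subst (_≤ r) (+-suc j _) bound) valss bs⊆σ
  ... | sorted , above =
    AllPairs.++⁺ (block-sorted levels (block-positions b⊆σ)) (above ∷ sorted)
      (All.map (λ x≡j → below x≡j ∷ All.map (<ₗₑₓ.trans (below x≡j)) above) levels) ,
    All.++⁺ (block-above levels vals) (inj₁ (n<1+n j) ∷ All.map (<ₗₑₓ.trans (inj₁ (n<1+n j))) above)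
    where
    levels : All (λ x → level x ≡ j) b
    levels = block-levels (m+n≤o⇒m≤o (suc j) (subst (_≤ r) (+-suc j _) bound)) b⊆σ
    below : ∀ {x} → level x ≡ j → key x <ₗₑₓ (suc j , 0)
    below x≡j = inj₁ (subst (_< suc j) (sym x≡j) (n<1+n j))

  sorted-G0 : ∀ {w} → IsG0 w → oneLine σ ∈CL w → AllPairs _<ₖ_ w
  sorted-G0 {w} (π′ , il) σ∈CLw
    with Interleaving⇒joinFrom 0 (r ∸ 1) (All.tabulate⁺ (λ _ → tt))
           (subst (λ zs → Interleaving (oneLine π′) zs w) zeros≡zerosFrom il)
  ... | b , bs , length≡ , vals , refl = proj₁ (joinFrom-sorted 0 (b ∷ bs) bound vals
          (ShuffleOf⇒⊆ (subst (λ ls → ShuffleOf (shiftFrom 0 ls) (oneLine σ))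
                              (subwords-joinFrom 0 b bs vals) σ∈CLw)))
    where
    bound : suc (length bs) ≤ r
    bound = ≤-reflexive (trans (cong suc length≡) (suc-pred r))

module KeySorted {r n : ℕ} .{{_ : NonZero r}} (σ π : G r n) where

  open Key σ

  -- πLetter m is the letter of π with the absolute value of σ(m); w₀ lists these level by level,
  -- each level in the order of m, with 0_1, …, 0_{r-1} between consecutive levels.

  πIndex : Fin n → Fin n
  πIndex m = flip (perm π) ⟨$⟩ʳ (perm σ ⟨$⟩ʳ m)

  πLetter : Fin n → Letter r n
  πLetter m = at π (πIndex m)

  πLevel : Fin n → ℕ
  πLevel = level ∘ πLetter

  shift-πLetter : ∀ m → shiftLetter (πLevel m) (πLetter m) ≡ at σ m
  shift-πLetter m = trans (shift-by-level (col π (πIndex m)) _)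
    (cong (at σ) (trans (cong (perm (σ ⁻¹) ⟨$⟩ʳ_) (inverseʳ (perm π))) (inverseˡ (perm σ))))

  classes : List (List (Fin n))
  classes = fibresFrom πLevel 0 (suc (r ∸ 1)) (allFin n)

  blocks : List (List (Letter r n))
  blocks = map (map πLetter) classes

  w₀ : List (Letter r n)
  w₀ = joinFrom 0 blocks

  classes-shuffle : ShuffleOf classes (allFin n)
  classes-shuffle = ShuffleOf-fibresFrom πLevel 0 (suc (r ∸ 1)) (allFin n)
    (All.universal (λ m → z≤n , subst (πLevel m <_) (sym (suc-pred r)) (toℕ<n _)) (allFin n))

  shift-block : ∀ j ms → All (λ m → πLevel m ≡ j) ms → map (shiftLetter j) (map πLetter ms) ≡ map (at σ) ms
  shift-block j ms levels = trans (sym (map-∘ ms)) (map-cong-local (All.map shift-at-level levels))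
    where
    shift-at-level : ∀ {m} → πLevel m ≡ j → shiftLetter j (πLetter m) ≡ at σ m
    shift-at-level {m} m≡j = subst (λ k → shiftLetter k (πLetter m) ≡ at σ m) m≡j (shift-πLetter m)

  shiftFrom-blocks : ∀ j c → shiftFrom j (map (map πLetter) (fibresFrom πLevel j c (allFin n)))
                             ≡ map (map (at σ)) (fibresFrom πLevel j c (allFin n))
  shiftFrom-blocks j zero    = refl
  shiftFrom-blocks j (suc c) =
    cong₂ _∷_ (shift-block j _ (All.all-filter (λ m → πLevel m ≟ j) (allFin n))) (shiftFrom-blocks (suc j) c)

  blocks-val : All (All IsVal) blocks
  blocks-val = All.map⁺ (All.universal (λ ms → All.map⁺ (All.universal (λ _ → tt) ms)) classes)

  σ∈CLw₀ : oneLine σ ∈CL w₀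
  σ∈CLw₀ = subst₂ ShuffleOf (sym pis-w₀) (map-tabulate id (at σ)) (ShuffleOf-map (at σ) classes-shuffle)
    where
    pis-w₀ : pis w₀ ≡ map (map (at σ)) classes
    pis-w₀ = trans (cong (shiftFrom 0) (subwords-joinFrom 0 _ _ blocks-val))
                   (shiftFrom-blocks 0 (suc (r ∸ 1)))

  concat-blocks↭ : concat blocks ↭ oneLine π
  concat-blocks↭ = begin
    concat (map (map πLetter) classes)  ≡⟨ concat-map classes ⟩
    map πLetter (concat classes)        ↭⟨ ↭.map⁺ πLetter (↭-sym (ShuffleOf⇒↭concat classes-shuffle)) ⟩
    map πLetter (allFin n)              ≡⟨ map-∘ (allFin n) ⟩
    map (at π) (map πIndex (allFin n))  ↭⟨ ↭.map⁺ (at π) (map-allFin-↭ (perm σ ∘ₚ flip (perm π))) ⟩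
    map (at π) (allFin n)               ≡⟨ map-tabulate id (at π) ⟩
    oneLine π                           ∎
    where open PermutationReasoning

  w₀-interleaving : Interleaving (concat blocks) (zeros r n) w₀
  w₀-interleaving =
    subst (λ zs → Interleaving (concat blocks) zs w₀) (sym zeros≡) (joinFrom-interleaving 0 _ higherBlocks)
    where
    higherClasses : List (List (Fin n))
    higherClasses = fibresFrom πLevel 1 (r ∸ 1) (allFin n)
    higherBlocks : List (List (Letter r n))
    higherBlocks = map (map πLetter) higherClasses
    zeros≡ : zeros r n ≡ zerosFrom 0 (length higherBlocks)
    zeros≡ = trans zeros≡zerosFrom (cong (zerosFrom 0)
      (sym (trans (length-map _ higherClasses) (length-fibresFrom πLevel 1 (r ∸ 1) (allFin n)))))

  w₀∈G0 : IsG0 w₀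
  w₀∈G0 = let π′ , oneLine≡ = ↭-oneLine π concat-blocks↭ in
    π′ , subst (λ l → Interleaving l (zeros r n) w₀) (sym oneLine≡) w₀-interleaving

  w₀↭ : w₀ ↭ oneLine π ++ zeros r n
  w₀↭ = ↭-trans (toPermutation w₀-interleaving) (↭.++⁺ʳ (zeros r n) concat-blocks↭)

module Descents {r n : ℕ} .{{_ : NonZero r}} (r≥2 : 2 ≤ r) (σ π : G r n) where

  open Key σ
  open ColourArithmetic r using (toℕ-mod-<)

  τ : G r n
  τ = (σ ⁻¹) · π

  coords-atNext : ∀ i → coords (atNext τ i) ≡ key (atNext π i)
  coords-atNext i with nextIdx i
  ... | just _  = refl
  ... | nothing = cong (_, 0) (toℕ-mod-< r≥2)   -- π(n+1) = 0_1 has colour 1 mod r, which is 1 as r ≥ 2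

  ∈-Des⇔descent : ∀ i → i ∈ₛ Des τ ⇔ atNext π i <ₖ at π i
  ∈-Des⇔descent i = mk⇔
    (λ i∈Des → subst (_<ₗₑₓ key (at π i)) (coords-atNext i) (Equivalence.to (∈-Des⇔ τ i) i∈Des))
    (λ descent → Equivalence.from (∈-Des⇔ τ i) (subst (_<ₗₑₓ key (at π i)) (sym (coords-atNext i)) descent))

  ∉-Des⇒ascent : ∀ i → i ∉ₛ Des τ → at π i <ₖ atNext π i
  ∉-Des⇒ascent i i∉Des with <ₗₑₓ.compare (key (at π i)) (key (atNext π i))
  ... | tri< ascent _ _   = ascent
  ... | tri≈ _ (_ , eq) _ = ⊥-elim (absOf-at≢absOf-atNext τ i (trans eq (sym (cong proj₂ (coords-atNext i)))))
  ... | tri> _ _ descent  = ⊥-elim (i∉Des (Equivalence.from (∈-Des⇔descent i) descent))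

  InCLP-Z⇒Des≡ : ∀ I → InCLP (Z I π) (oneLine σ) → Des τ ≡ I
  InCLP-Z⇒Des≡ I (w , (w∈G0 , _ , ≺⇒LeftOf) , σ∈CLw) = Subset.⊆-antisym Des⊆I I⊆Des
    where
    precedes : ∀ {x y} → ZGen I π x y → x <ₖ y
    precedes x≺y = LeftOf⇒related (sorted-G0 w∈G0 σ∈CLw) (≺⇒LeftOf _ _ [ x≺y ])
    I⊆Des : I ⊆ₛ Des τ
    I⊆Des i∈I = Equivalence.from (∈-Des⇔descent _) (precedes (down _ i∈I))
    Des⊆I : Des τ ⊆ₛ I
    Des⊆I {i} i∈Des with i Subset.∈? I
    ... | yes i∈I = i∈I
    ... | no  i∉I = ⊥-elim (<ₗₑₓ.asym (precedes (up i i∉I)) (Equivalence.to (∈-Des⇔descent i) i∈Des))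

  ZGen⇒<ₖ : ∀ {I x y} → Des τ ≡ I → ZGen I π x y → x <ₖ y
  ZGen⇒<ₖ _    (zchain k _ _) = inj₁ (n<1+n k)
  ZGen⇒<ₖ refl (up i i∉I)     = ∉-Des⇒ascent i i∉I
  ZGen⇒<ₖ refl (down i i∈I)   = Equivalence.to (∈-Des⇔descent i) i∈I

  zer∈zeros : ∀ {k} → suc k < r → zer (suc k) ∈ zeros r n
  zer∈zeros k+1<r = ∈-map⁺ (zer ∘ suc) (∈-upTo⁺ (suc[m]≤n⇒m≤pred[n] k+1<r))

  at∈ : ∀ i → at π i ∈ oneLine π ++ zeros r n
  at∈ i = ∈-++⁺ˡ (∈-tabulate⁺ i)

  atNext∈ : ∀ i → atNext π i ∈ oneLine π ++ zeros r n
  atNext∈ i with nextIdx i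
  ... | just j  = at∈ j
  ... | nothing = ∈-++⁺ʳ _ (zer∈zeros r≥2)

  ZGen⇒∈ : ∀ {I x y} → ZGen I π x y → x ∈ elems (Z I π) × y ∈ elems (Z I π)
  ZGen⇒∈ (zchain (suc k) _ k+2<r) =
    ∈-++⁺ʳ _ (zer∈zeros (<-trans (n<1+n _) k+2<r)) , ∈-++⁺ʳ _ (zer∈zeros k+2<r)
  ZGen⇒∈ (up i _)                 = at∈ i , atNext∈ i
  ZGen⇒∈ (down i _)               = atNext∈ i , at∈ i

  closure⇒<ₖ : ∀ {I x y} → Des τ ≡ I → TransClosure (ZGen I π) x y → x <ₖ y
  closure⇒<ₖ Des≡I [ x≺y ]       = ZGen⇒<ₖ Des≡I x≺y
  closure⇒<ₖ Des≡I (x≺y ∷ y≺⁺z) = <ₗₑₓ.trans (ZGen⇒<ₖ Des≡I x≺y) (closure⇒<ₖ Des≡I y≺⁺z)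

  closure⇒∈ : ∀ {I x y} → TransClosure (ZGen I π) x y → x ∈ elems (Z I π) × y ∈ elems (Z I π)
  closure⇒∈ [ x≺y ]       = ZGen⇒∈ x≺y
  closure⇒∈ (x≺y ∷ y≺⁺z) = proj₁ (ZGen⇒∈ x≺y) , proj₂ (closure⇒∈ y≺⁺z)

  Des≡⇒InCLP-Z : ∀ I → Des τ ≡ I → InCLP (Z I π) (oneLine σ)
  Des≡⇒InCLP-Z I Des≡I = w₀ , (w₀∈G0 , w₀↭ , ≺⇒LeftOf) , σ∈CLw₀
    where
    open KeySorted σ π
    ∈w₀ : ∀ {x} → x ∈ elems (Z I π) → x ∈ w₀
    ∈w₀ = ↭.∈-resp-↭ (↭-sym w₀↭)
    ≺⇒LeftOf : ∀ x y → TransClosure (ZGen I π) x y → LeftOf x y w₀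
    ≺⇒LeftOf x y x≺⁺y = related⇒LeftOf <ₗₑₓ.asym (sorted-G0 w₀∈G0 σ∈CLw₀)
      (∈w₀ (proj₁ (closure⇒∈ x≺⁺y))) (∈w₀ (proj₂ (closure⇒∈ x≺⁺y))) (closure⇒<ₖ Des≡I x≺⁺y)

mainTheorem10 : (r n : ℕ) .{{_ : NonZero r}} → 2 ≤ r →
    (σ π : G r n) (I : Subset n) →
    InCLP (Z I π) (oneLine σ) ⇔ (Des ((σ ⁻¹) · π) ≡ I)
mainTheorem10 r n r≥2 σ π I = mk⇔ (InCLP-Z⇒Des≡ I) (Des≡⇒InCLP-Z I)
  where open Descents r≥2 σ π
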